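{- Let $d_0\geq 1$ and $k\geq 1$ be integers and let $q$ be a prime power with $q>d_0k$. For $i\geq 1$ let $d_i=\lceil q^{2^i}/k\rceil-1$. Then (after suitable row and column permutations as described in the context) $(\mathbf{C}_{q^{2^i},k,d_i})_{i\geq 0}$ is an embedding family of CFFs. Moreover, writing $n_i=q^{2^i(k+1)}$ for the number of columns and $t_i$ for the number of rows of the $i$-th matrix, its compression ratio is $\rho(n)=n^{1-\frac{2}{k+1}}$ (i.e. $n_i/t_i$ is $O(n_i^{1-2/(k+1)})$), and $d_i\sim n_i^{1/(k+1)}/k$.
   Context: A $d$-CFF$(t,n)$ is a set system with $t$ points and $n$ blocks in which no block is contained in the union of any $d$ other blocks, represented by its $t\times n$ binary incidence matrix. For a prime power $r$ with $\mathbb{F}_r=\{x_1,\dots,x_r\}$ in a fixed order and positive integers $\kappa,\delta$ with $r\ge\delta\kappa+1$, $C_{r,\kappa,\delta}$ is the $(\delta\kappa+1)r\times r^{\kappa+1}$ binary matrix with rows indexed by $(x_j,y)$, $1\le j\le\delta\kappa+1$, $y\in\mathbb{F}_r$, columns indexed by polynomials $f$ over $\mathbb{F}_r$ of degree at most $\kappa$, entry $1$ iff $f(x_j)=y$; it is a $\delta$-CFF. The fields $\mathbb{F}_{q^{2^i}}\subseteq \mathbb{F}_{q^{2^{i+1}}}$ are nested with compatible orderings (elements of the subfield listed first), and $\mathbf{C}_{q^{2^{i}},k,d_i}$ denotes $C_{q^{2^{i}},k,d_i}$ with rows and columns permuted so that the rows $(x_j,y)$ with $j\le d_{i-1}k+1$,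 $y\in\mathbb{F}_{q^{2^{i-1}}}$ and the columns indexed by polynomials over $\mathbb{F}_{q^{2^{i-1}}}$ come first. An embedding family is a sequence $(\mathcal{M}^{(l)})_l$ of incidence matrices of set systems $(X_l,\mathcal{B}_l)$, $\mathcal{M}^{(l)}$ a $d(l)$-CFF, with $X_l\subseteq X_{l+1}$, nondecreasing numbers of rows and columns, $d(l)\le d(l+1)$, and $\mathcal{M}^{(l)}$ equal to the upper-left submatrix of $\mathcal{M}^{(l+1)}$ of its size. -}

module Defs where

open import Data.Nat using (ℕ; zero; suc; _+_; _*_; _∸_; _^_; _≤_; _<_)
open import Data.Nat.DivMod using (_/_)
open import Data.Nat.Primality using (Prime)
open import Data.Fin using (Fin; toℕ; inject≤)
import Data.Fin as Fin
open import Data.Vec using (Vec; []; _∷_)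
open import Data.List using (List; length)
open import Data.List.Membership.Propositional using (_∈_)
open import Data.Bool using (Bool; true; false)
open import Data.Maybe using (Maybe; just; nothing)
open import Data.Product using (Σ; ∃; _×_; _,_)
open import Relation.Binary.PropositionalEquality using (_≡_; _≢_)
open import Relation.Nullary.Decidable using (⌊_⌋)
open import Algebra.Structures using (IsCommutativeRing)

IsPrimePower : ℕ → Set
IsPrimePower q = Σ ℕ λ p → Σ ℕ λ s → Prime p × q ≡ p ^ suc s

-- A (finite) field whose carrier is Fin r; the order x₁,…,x_r of the
-- field elements is the order of Fin r.
record FinField (r : ℕ) : Set where
  field
    _+F_ _*F_ : Fin r → Fin r → Fin r
    -F_ : Fin r → Fin r
    0F 1F : Fin r
    isCommutativeRing : IsCommutativeRing _≡_ _+F_ _*F_ -F_ 0F 1F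
    0≢1 : 0F ≢ 1F
    inverse : ∀ x → x ≢ 0F → ∃ λ y → x *F y ≡ 1F

record IsFieldHom {r s : ℕ} (F : FinField r) (G : FinField s) (h : Fin r → Fin s) : Set where
  private
    module F = FinField F
    module G = FinField G
  field
    hom-+ : ∀ x y → h (x F.+F y) ≡ h x G.+F h y
    hom-* : ∀ x y → h (x F.*F y) ≡ h x G.*F h y
    hom-1 : h F.1F ≡ G.1F

nth : (r j : ℕ) → Maybe (Fin r)
nth zero j = nothing
nth (suc r) zero = just Fin.zero
nth (suc r) (suc j) with nth r j
... | just x = just (Fin.suc x)
... | nothing = nothing

evalPoly : ∀ {r m} → FinField r → Vec (Fin r) m → Fin r → Fin r
evalPoly F [] x = FinField.0F F
evalPoly F (a ∷ as) x = FinField._+F_ F a (FinField._*F_ F x (evalPoly F as x))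

-- C_{r,κ,δ}: rows (x_j , y) with j = 1..δκ+1 (here j : Fin (δκ+1), x_j the
-- (toℕ j)-th element of F_r), columns polynomials of degree ≤ κ
-- (coefficient vectors of length κ+1); entry 1 iff f(x_j) = y.
CMat : ∀ {r} → FinField r → (κ δ : ℕ) →
       Fin (δ * κ + 1) × Fin r → Vec (Fin r) (suc κ) → Bool
CMat {r} F κ δ (j , y) f with nth r (toℕ j)
... | just x = ⌊ evalPoly F f x Fin.≟ y ⌋
... | nothing = false

IsCFF : ∀ {t n} → ℕ → (Fin t → Fin n → Bool) → Set
IsCFF {t} {n} d M =
  (c : Fin n) (S : List (Fin n)) → length S ≤ d → (∀ {s} → s ∈ S → s ≢ c) →
  Σ (Fin t) λ x → M x c ≡ true × (∀ {s} → s ∈ S → M x s ≡ false)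

-- embedding family of CFFs; point sets Fin (t l), X_l ⊆ X_{l+1} via inject≤
record IsEmbeddingFamily (t n d : ℕ → ℕ)
       (M : (l : ℕ) → Fin (t l) → Fin (n l) → Bool) : Set where
  field
    t-mono : ∀ l → t l ≤ t (suc l)
    n-mono : ∀ l → n l ≤ n (suc l)
    d-mono : ∀ l → d l ≤ d (suc l)
    cff : ∀ l → IsCFF (d l) (M l)
    upper-left : ∀ l (x : Fin (t l)) (c : Fin (n l)) →
      M l x c ≡ M (suc l) (inject≤ x (t-mono l)) (inject≤ c (n-mono l))

ceilDiv : ℕ → ℕ → ℕ
ceilDiv a zero = 0
ceilDiv a (suc k) = (a + k) / suc k

dSeq : ℕ → ℕ → ℕ → ℕ → ℕ
dSeq d₀ k q zero = d₀
dSeq d₀ k q (suc i) = ceilDiv (q ^ (2 ^ suc i)) k ∸ 1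

absDiff : ℕ → ℕ → ℕ
absDiff a b = (a ∸ b) + (b ∸ a)

-- Two distinct polynomials of degree at most k over a field agree in at most k points, so
-- the columns of d polynomials other than f meet the column of f in at most dk of the
-- dk + 1 evaluation points; at a remaining point x the row (x , f x) separates f from them,
-- which makes C_{r,k,d} a d-CFF. The order-preserving embeddings
-- F_{q^{2^i}} ⊆ F_{q^{2^{i+1}}} commute with evaluation, so C_i is the submatrix of C_{i+1}
-- on the rows and columns defined over the subfield; enumerating, level by level, the old
-- rows (a subrectangle of Fin D × Fin m) and the old columns (coefficient vectors over the
-- subfield) before the new ones moves that submatrix to the upper-left corner. The rest is
-- arithmetic of d_i = ⌈m_i / k⌉ - 1 for m_i = q^{2^i}: d_i k < m_i ≤ d_i k + k, so
-- t_i = (d_i k + 1) m_i is within a factor qk of m_i ^ 2 = n_i ^ (2/(k+1)), and for i ≥ 1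
-- d_i k differs from n_i ^ (1/(k+1)) by at most k.
module Submission where

open import Defs
open import Data.Fin using (Fin; toℕ)
open import Relation.Binary.PropositionalEquality using (_≡_)

module Counting where
  open import Data.Nat using (ℕ; suc; _+_; _*_; _≤_; _<_)
  import Data.Nat.Properties as ℕ
  open import Data.List using (List; []; _∷_; length; filter)
  open import Data.List.Relation.Unary.All using (All; []; _∷_)
  open import Data.List.Relation.Unary.All.Properties using (all-filter)
  open import Data.List.Relation.Unary.Unique.Propositional using (Unique)
  import Data.List.Relation.Unary.Unique.Propositional.Properties as Unique
  open import Data.List.Membership.Propositional using (_∈_)
  open import Data.List.Membership.Propositional.Properties using (∈-filter⁻)
  open import Data.List.Relation.Unary.Any using (here)
  open import Data.Product using (Σ; _×_; _,_)
  open import Relation.Binary.PropositionalEquality using (refl; cong; trans)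
  open import Relation.Nullary using (¬_; yes; no)
  open import Relation.Unary using (Pred; Decidable)
  open import Relation.Unary.Properties using (∁?)

  length-filter+filter-∁ : ∀ {a p} {A : Set a} {P : Pred A p} (P? : Decidable P) (xs : List A) →
                           length (filter P? xs) + length (filter (∁? P?) xs) ≡ length xs
  length-filter+filter-∁ P? [] = refl
  length-filter+filter-∁ P? (x ∷ xs) with P? x
  ... | yes _ = cong suc (length-filter+filter-∁ P? xs)
  ... | no _ = trans (ℕ.+-suc _ _) (cong suc (length-filter+filter-∁ P? xs))

  module _ {a b ℓ} {A : Set a} {B : Set b} {Bad : B → A → Set ℓ}
           (Bad? : ∀ s → Decidable (Bad s)) {k : ℕ} where

    avoid-all : (S : List B) → All (λ s → ∀ {ys} → Unique ys → All (Bad s) ys → length ys ≤ k) S →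
                (xs : List A) → Unique xs → k * length S < length xs →
                Σ A λ x → x ∈ xs × All (λ s → ¬ Bad s x) S
    avoid-all [] _ (x ∷ _) _ _ = x , here refl , []
    avoid-all (s ∷ S) (bound ∷ bounds) xs xs! k*|s∷S|<|xs| =
      let x , x∈good , avoids = avoid-all S bounds good (Unique.filter⁺ (∁? (Bad? s)) xs!) k*|S|<|good|
          x∈xs , ¬bad = ∈-filter⁻ (∁? (Bad? s)) x∈good
      in x , x∈xs , ¬bad ∷ avoids
      where
        good bad : List A
        good = filter (∁? (Bad? s)) xs
        bad = filter (Bad? s) xs
        |bad|≤k : length bad ≤ k
        |bad|≤k = bound (Unique.filter⁺ (Bad? s) xs!) (all-filter (Bad? s) xs)
        k*|S|<|good| : k * length S < length good
        k*|S|<|good| = ℕ.+-cancelˡ-< k _ _ (begin-strict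
          k + k * length S          ≡⟨ ℕ.*-suc k (length S) ⟨
          k * suc (length S)        <⟨ k*|s∷S|<|xs| ⟩
          length xs                 ≡⟨ length-filter+filter-∁ (Bad? s) xs ⟨
          length bad + length good  ≤⟨ ℕ.+-monoˡ-≤ (length good) |bad|≤k ⟩
          k + length good           ∎)
          where open ℕ.≤-Reasoning

module Polynomial {r} (F : FinField r) where
  open import Data.Nat using (zero; suc; _≤_; s≤s)
  import Data.Nat.Properties as ℕ
  open import Data.Vec using (Vec; []; _∷_)
  open import Data.Vec.Properties using (∷-injectiveˡ; ∷-injectiveʳ)
  open import Data.List using (_∷_; length)
  open import Data.List.Relation.Unary.All using (All; _∷_)
  import Data.List.Relation.Unary.All as All
  open import Data.List.Relation.Unary.Unique.Propositional using (Unique; _∷_)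
  open import Data.Product using (_,_)
  open import Relation.Binary.PropositionalEquality
  open import Algebra.Bundles using (CommutativeRing)
  open import Algebra.Definitions (_≡_ {A = Fin r}) using (AlmostLeftCancellative)
  open FinField F using (isCommutativeRing; inverse)

  commutativeRing : CommutativeRing _ _
  commutativeRing = record { isCommutativeRing = isCommutativeRing }

  open CommutativeRing commutativeRing
    using (_+_; _*_; -_; _-_; 0#; 1#; +-assoc; +-identityʳ; *-comm; *-assoc; *-identityˡ;
           *-commutativeSemigroup; distribˡ; distribʳ; zeroʳ)
  open import Algebra.Properties.Ring (CommutativeRing.ring commutativeRing)
    using (x∙y⁻¹≈ε⇒x≈y; xyx⁻¹≈y; +-cancelˡ; +-cancelʳ)
  open import Algebra.Properties.CommutativeSemigroup *-commutativeSemigroup using (x∙yz≈y∙xz)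

  *-almostCancelˡ : AlmostLeftCancellative 0# _*_
  *-almostCancelˡ c a b c≢0 ca≡cb with inverse c c≢0
  ... | c⁻¹ , cc⁻¹≡1 = begin
    a              ≡⟨ *-identityˡ a ⟨
    1# * a         ≡⟨ cong (_* a) (trans (sym cc⁻¹≡1) (*-comm c c⁻¹)) ⟩
    c⁻¹ * c * a    ≡⟨ *-assoc c⁻¹ c a ⟩
    c⁻¹ * (c * a)  ≡⟨ cong (c⁻¹ *_) ca≡cb ⟩
    c⁻¹ * (c * b)  ≡⟨ *-assoc c⁻¹ c b ⟨
    c⁻¹ * c * b    ≡⟨ cong (_* b) (trans (*-comm c⁻¹ c) cc⁻¹≡1) ⟩
    1# * b         ≡⟨ *-identityˡ b ⟩
    b              ∎
    where open ≡-Reasoning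

  ev : ∀ {n} → Vec (Fin r) n → Fin r → Fin r
  ev = evalPoly F

  quot : ∀ {n} → Fin r → Vec (Fin r) (suc n) → Vec (Fin r) n
  quot α (a ∷ []) = []
  quot α (a ∷ as@(_ ∷ _)) = ev as α ∷ quot α as

  ev-quot : ∀ {n} α (p : Vec (Fin r) (suc n)) x → ev p x ≡ ev p α + (x - α) * ev (quot α p) x
  ev-quot α (a ∷ []) x = begin
    a + x * 0#                 ≡⟨ cong (a +_) (trans (zeroʳ x) (sym (zeroʳ α))) ⟩
    a + α * 0#                 ≡⟨ +-identityʳ _ ⟨
    a + α * 0# + 0#            ≡⟨ cong (a + α * 0# +_) (zeroʳ (x - α)) ⟨
    a + α * 0# + (x - α) * 0#  ∎
    where open ≡-Reasoning
  ev-quot α (a ∷ as@(_ ∷ _)) x = begin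
    a + x * ev as x                                  ≡⟨ cong (λ v → a + x * v) (ev-quot α as x) ⟩
    a + x * (E + (x - α) * Q)                        ≡⟨ cong (a +_) (distribˡ x E _) ⟩
    a + (x * E + x * ((x - α) * Q))                  ≡⟨ cong (λ v → a + (v * E + x * ((x - α) * Q))) α+[x-α]≡x ⟨
    a + ((α + (x - α)) * E + x * ((x - α) * Q))      ≡⟨ cong₂ (λ u v → a + (u + v)) (distribʳ E α (x - α))
                                                                                    (x∙yz≈y∙xz x (x - α) Q) ⟩
    a + (α * E + (x - α) * E + (x - α) * (x * Q))    ≡⟨ cong (a +_) (+-assoc (α * E) _ _) ⟩
    a + (α * E + ((x - α) * E + (x - α) * (x * Q)))  ≡⟨ +-assoc a (α * E) _ ⟨
    a + α * E + ((x - α) * E + (x - α) * (x * Q))    ≡⟨ cong (a + α * E +_) (distribˡ (x - α) E (x * Q)) ⟨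
    a + α * E + (x - α) * (E + x * Q)                ∎
    where
      open ≡-Reasoning
      E Q : Fin r
      E = ev as α
      Q = ev (quot α as) x
      α+[x-α]≡x : α + (x - α) ≡ x
      α+[x-α]≡x = trans (sym (+-assoc α x (- α))) (xyx⁻¹≈y α x)

  quot-injective : ∀ {n} α (p q : Vec (Fin r) (suc n)) → ev p α ≡ ev q α → quot α p ≡ quot α q → p ≡ q
  quot-injective α (a ∷ []) (b ∷ []) pα≡qα _ = cong (_∷ []) (+-cancelʳ (α * 0#) a b pα≡qα)
  quot-injective α (a ∷ as@(_ ∷ _)) (b ∷ bs@(_ ∷ _)) pα≡qα quot≡ = cong₂ _∷_ a≡b as≡bs
    where
      asα≡bsα : ev as α ≡ ev bs α
      asα≡bsα = ∷-injectiveˡ quot≡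
      as≡bs : as ≡ bs
      as≡bs = quot-injective α as bs asα≡bsα (∷-injectiveʳ quot≡)
      a≡b : a ≡ b
      a≡b = +-cancelʳ (α * ev bs α) a b (subst (λ v → a + α * v ≡ b + α * ev bs α) asα≡bsα pα≡qα)

  quot-agree : ∀ {n} α (p q : Vec (Fin r) (suc n)) → ev p α ≡ ev q α →
               ∀ {x} → α ≢ x → ev p x ≡ ev q x → ev (quot α p) x ≡ ev (quot α q) x
  quot-agree α p q pα≡qα {x} α≢x px≡qx =
    *-almostCancelˡ (x - α) _ _ x-α≢0 (+-cancelˡ (ev p α) _ _ (begin
      ev p α + (x - α) * ev (quot α p) x  ≡⟨ ev-quot α p x ⟨
      ev p x                              ≡⟨ px≡qx ⟩
      ev q x                              ≡⟨ ev-quot α q x ⟩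
      ev q α + (x - α) * ev (quot α q) x  ≡⟨ cong (_+ _) pα≡qα ⟨
      ev p α + (x - α) * ev (quot α q) x  ∎))
    where
      open ≡-Reasoning
      x-α≢0 : x - α ≢ 0#
      x-α≢0 x-α≡0 = α≢x (sym (x∙y⁻¹≈ε⇒x≈y x α x-α≡0))

  agree⇒≡ : ∀ {n} (p q : Vec (Fin r) (suc n)) {xs} → Unique xs → suc n ≤ length xs →
            All (λ x → ev p x ≡ ev q x) xs → p ≡ q
  agree⇒≡ {zero} p@(_ ∷ []) q@(_ ∷ []) {α ∷ _} _ _ (pα≡qα ∷ _) = quot-injective α p q pα≡qα refl
  agree⇒≡ {suc n} p q {α ∷ xs} (α∉xs ∷ xs!) (s≤s n<|xs|) (pα≡qα ∷ agree) =
    quot-injective α p q pα≡qα (agree⇒≡ (quot α p) (quot α q) xs! n<|xs| quot-agrees)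
    where
      quot-agrees : All (λ x → ev (quot α p) x ≡ ev (quot α q) x) xs
      quot-agrees = All.zipWith (λ (α≢x , px≡qx) → quot-agree α p q pα≡qα α≢x px≡qx) (α∉xs , agree)

  agreements-≤ : ∀ {n} {p q : Vec (Fin r) (suc n)} → p ≢ q →
                 ∀ {xs} → Unique xs → All (λ x → ev p x ≡ ev q x) xs → length xs ≤ n
  agreements-≤ p≢q xs! agree = ℕ.≮⇒≥ (λ n<|xs| → p≢q (agree⇒≡ _ _ xs! n<|xs| agree))

module CoverFree where
  open import Data.Nat using (ℕ; suc; _+_; _*_; _≤_; _<_; z<s)
  import Data.Nat.Properties as ℕ
  open import Data.Fin using (inject≤; _≟_)
  import Data.Fin as Fin
  open import Data.Fin.Properties using (toℕ-inject≤; inject≤-injective)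
  open import Data.Vec using (Vec)
  open import Data.List using (List; length; map; tabulate)
  open import Data.List.Properties using (length-map; length-tabulate)
  import Data.List.Relation.Unary.All as All
  open import Data.List.Relation.Unary.Unique.Propositional.Properties using (tabulate⁺)
  open import Data.List.Membership.Propositional using (_∈_)
  open import Data.List.Membership.Propositional.Properties using (∈-map⁺; ∈-map⁻; ∈-tabulate⁻)
  open import Data.Bool using (Bool; true; false)
  open import Data.Maybe using (just)
  open import Data.Product using (Σ; _×_; _,_)
  open import Function.Bundles using (_⤖_; Bijection)
  open import Relation.Binary.PropositionalEquality
  open import Relation.Nullary.Decidable using (does; isYes≗does; dec-true; dec-false)
  open Bijection using (to; injective; strictlySurjective)

  IsCoverFree : ∀ {a b} {R : Set a} {C : Set b} → ℕ → (R → C → Bool) → Set _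
  IsCoverFree {R = R} {C} d M =
    (c : C) (S : List C) → length S ≤ d → (∀ {s} → s ∈ S → s ≢ c) →
    Σ R λ x → M x c ≡ true × (∀ {s} → s ∈ S → M x s ≡ false)

  IsCoverFree⇒IsCFF : ∀ {a b} {R : Set a} {C : Set b} {d t n} {M : R → C → Bool} →
                      IsCoverFree d M → (σ : Fin t ⤖ R) (τ : Fin n ⤖ C) →
                      IsCFF d (λ x c → M (to σ x) (to τ c))
  IsCoverFree⇒IsCFF cf σ τ c S |S|≤d S∌c
    with cf (to τ c) (map (to τ) S) (subst (_≤ _) (sym (length-map (to τ) S)) |S|≤d) τS∌τc
    where
      τS∌τc : ∀ {s′} → s′ ∈ map (to τ) S → s′ ≢ to τ c
      τS∌τc s′∈τS with ∈-map⁻ (to τ) s′∈τS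
      ... | s , s∈S , refl = λ τs≡τc → S∌c s∈S (injective τ τs≡τc)
  ... | p , Mpc , MpS with strictlySurjective σ p
  ... | x , refl = x , Mpc , λ s∈S → MpS (∈-map⁺ (to τ) s∈S)

  nth-toℕ : ∀ {r} (x : Fin r) → nth r (toℕ x) ≡ just x
  nth-toℕ Fin.zero = refl
  nth-toℕ {suc r} (Fin.suc x) rewrite nth-toℕ x = refl

  CMat-at : ∀ {r} (F : FinField r) κ δ (le : δ * κ + 1 ≤ r) j y (f : Vec (Fin r) (suc κ)) →
            CMat F κ δ (j , y) f ≡ does (evalPoly F f (inject≤ j le) ≟ y)
  CMat-at {r} F κ δ le j y f
    with nth r (toℕ j) | trans (cong (nth r) (sym (toℕ-inject≤ j le))) (nth-toℕ (inject≤ j le))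
  ... | just x | refl = isYes≗does (evalPoly F f x ≟ y)

  module _ {r} (F : FinField r) (κ δ : ℕ) (le : δ * κ + 1 ≤ r) where
    open Polynomial F using (ev; agreements-≤)
    open Counting using (avoid-all)

    points : List (Fin r)
    points = tabulate (λ j → inject≤ j le)

    CMat-isCoverFree : IsCoverFree δ (CMat F κ δ)
    CMat-isCoverFree c S |S|≤δ S∌c
      with avoid-all (λ s x → ev s x ≟ ev c x) S (All.tabulate (λ s∈S → agreements-≤ (S∌c s∈S)))
                     points (tabulate⁺ (inject≤-injective le le _ _)) κ*|S|<|points|
      where
        κ*|S|<|points| : κ * length S < length points
        κ*|S|<|points| = begin-strict
          κ * length S   ≤⟨ ℕ.*-monoʳ-≤ κ |S|≤δ ⟩
          κ * δ          ≡⟨ ℕ.*-comm κ δ ⟩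
          δ * κ          <⟨ ℕ.m<m+n (δ * κ) z<s ⟩
          δ * κ + 1      ≡⟨ length-tabulate _ ⟨
          length points  ∎
          where open ℕ.≤-Reasoning
    ... | x , x∈points , S≢c-at-x with ∈-tabulate⁻ x∈points
    ... | j , refl =
      (j , ev c x) ,
      trans (CMat-at F κ δ le j _ c) (dec-true (ev c x ≟ ev c x) refl) ,
      λ {s} s∈S → trans (CMat-at F κ δ le j _ s) (dec-false (ev s x ≟ ev c x) (All.lookup S≢c-at-x s∈S))

module Embedding {r s} (F : FinField r) (G : FinField s) (h : Fin r → Fin s)
                 (h-toℕ : ∀ x → toℕ (h x) ≡ toℕ x) (h-hom : IsFieldHom F G h) where
  open import Data.Nat using (suc; _+_; _*_; _≤_)
  open import Data.Fin using (inject≤; _≟_)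
  open import Data.Fin.Properties using (toℕ-injective; toℕ-inject≤)
  open import Data.Vec using (Vec; []; _∷_; map)
  open import Data.Vec.Properties using (map-cong)
  open import Data.Product using (_,_)
  open import Function.Bundles using (mk⇔)
  open import Relation.Binary.PropositionalEquality
  open import Relation.Nullary.Decidable using (does; does-⇔)
  open import Algebra.Bundles using (CommutativeRing)
  open import Algebra.Structures using (IsCommutativeRing)
  open import Algebra.Properties.Ring (CommutativeRing.ring (Polynomial.commutativeRing G))
    using (x+x≈x⇒x≈0)
  open CoverFree using (CMat-at)
  open IsFieldHom h-hom
  private
    module F = FinField F
    module G = FinField G

  h-injective : ∀ {a b} → h a ≡ h b → a ≡ b
  h-injective ha≡hb = toℕ-injective (trans (sym (h-toℕ _)) (trans (cong toℕ ha≡hb) (h-toℕ _)))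

  h≗inject≤ : (r≤s : r ≤ s) → ∀ x → h x ≡ inject≤ x r≤s
  h≗inject≤ r≤s x = toℕ-injective (trans (h-toℕ x) (sym (toℕ-inject≤ x r≤s)))

  h-0 : h F.0F ≡ G.0F
  h-0 = x+x≈x⇒x≈0 (h F.0F)
          (trans (sym (hom-+ F.0F F.0F)) (cong h (IsCommutativeRing.+-identityʳ F.isCommutativeRing F.0F)))

  evalPoly-hom : ∀ {n} (f : Vec (Fin r) n) x → evalPoly G (map h f) (h x) ≡ h (evalPoly F f x)
  evalPoly-hom [] x = sym h-0
  evalPoly-hom (a ∷ f) x = begin
    h a G.+F (h x G.*F evalPoly G (map h f) (h x))  ≡⟨ cong (λ v → h a G.+F (h x G.*F v)) (evalPoly-hom f x) ⟩
    h a G.+F (h x G.*F h (evalPoly F f x))          ≡⟨ cong (h a G.+F_) (hom-* x _) ⟨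
    h a G.+F h (x F.*F evalPoly F f x)              ≡⟨ hom-+ a _ ⟨
    h (a F.+F (x F.*F evalPoly F f x))              ∎
    where open ≡-Reasoning

  CMat-embedding : ∀ κ {δ δ′} (r≤s : r ≤ s) (le : δ * κ + 1 ≤ r) (le′ : δ * κ + 1 ≤ δ′ * κ + 1)
                   (le″ : δ′ * κ + 1 ≤ s) j y (f : Vec (Fin r) (suc κ)) →
                   CMat F κ δ (j , y) f ≡
                   CMat G κ δ′ (inject≤ j le′ , inject≤ y r≤s) (map (λ a → inject≤ a r≤s) f)
  CMat-embedding κ {δ} {δ′} r≤s le le′ le″ j y f = begin
    CMat F κ δ (j , y) f                         ≡⟨ CMat-at F κ δ le j y f ⟩
    does (evalPoly F f x ≟ y)                    ≡⟨ does-⇔ (mk⇔ (cong h) h-injective) (_ ≟ y) (_ ≟ h y) ⟩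
    does (h (evalPoly F f x) ≟ h y)              ≡⟨ cong (λ v → does (v ≟ h y)) (evalPoly-hom f x) ⟨
    does (evalPoly G (map h f) (h x) ≟ h y)      ≡⟨ cong₂ (λ g z → does (evalPoly G g (h x) ≟ z))
                                                          (map-cong ι≗h f) (ι≗h y) ⟨
    does (evalPoly G (map ι f) (h x) ≟ ι y)      ≡⟨ cong (λ z → does (evalPoly G (map ι f) z ≟ ι y)) hx≡x′ ⟩
    does (evalPoly G (map ι f) x′ ≟ ι y)         ≡⟨ CMat-at G κ δ′ le″ _ (ι y) (map ι f) ⟨
    CMat G κ δ′ (inject≤ j le′ , ι y) (map ι f)  ∎
    where
      open ≡-Reasoning
      ι : Fin r → Fin s
      ι a = inject≤ a r≤s
      ι≗h : ∀ a → ι a ≡ h a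
      ι≗h a = sym (h≗inject≤ r≤s a)
      x : Fin r
      x = inject≤ j le
      x′ : Fin s
      x′ = inject≤ (inject≤ j le′) le″
      hx≡x′ : h x ≡ x′
      hx≡x′ = toℕ-injective (begin
        toℕ (h x)            ≡⟨ h-toℕ x ⟩
        toℕ x                ≡⟨ toℕ-inject≤ j le ⟩
        toℕ j                ≡⟨ toℕ-inject≤ j le′ ⟨
        toℕ (inject≤ j le′)  ≡⟨ toℕ-inject≤ _ le″ ⟨
        toℕ x′               ∎)

open import Data.Nat using (ℕ; zero; suc; _+_; _*_; _∸_; _^_; _≤_; _<_; z≤n; s≤s)
open import Data.Vec using (Vec)
open import Data.Vec.Relation.Unary.All using (All)
open import Data.Product using (Σ; ∃; _×_; _,_; proj₁; proj₂)
open import Function.Bundles using (_⤖_; _⇔_; Bijection)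

module Enumeration where
  import Data.Nat.Properties as ℕ
  open import Data.Fin using (inject≤; cast; _↑ˡ_; fromℕ<; splitAt)
  import Data.Fin.Properties as Fin
  open import Data.Vec using ([]; _∷_; uncons)
  import Data.Vec as Vec
  open import Data.Vec.Relation.Unary.All using ([]; _∷_)
  open import Data.Sum using (_⊎_; inj₁)
  import Data.Sum as Sum
  open import Data.Sum.Algebra using (⊎-cong; ⊎-assoc)
  open import Data.Product using (uncurry)
  import Data.Product as Product
  open import Data.Product.Algebra using (×-cong; ×-distribˡ-⊎; ×-distribʳ-⊎)
  open import Function.Bundles using (_↔_; Inverse; Injection; mk↔ₛ′; mk⇔)
  open import Function.Properties.Inverse using (↔-refl; ↔-sym; ↔-trans; ↔⇒↣)
  open import Relation.Binary.PropositionalEquality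
  open Inverse using (to; from; strictlyInverseˡ)

  cast↔ : ∀ {m n} → m ≡ n → Fin m ↔ Fin n
  cast↔ eq = mk↔ₛ′ (cast eq) (cast (sym eq)) (Fin.cast-involutive eq (sym eq)) (Fin.cast-involutive (sym eq) eq)

  cast-↑ˡ : ∀ {m n k} (eq : m + n ≡ k) (x : Fin m) (le : m ≤ k) → cast eq (x ↑ˡ n) ≡ inject≤ x le
  cast-↑ˡ eq x le =
    Fin.toℕ-injective (trans (Fin.toℕ-cast eq _) (trans (Fin.toℕ-↑ˡ x _) (sym (Fin.toℕ-inject≤ x le))))

  splitAt-cast-inject≤ : ∀ {m n k} (eq : k ≡ m + n) (x : Fin m) (le : m ≤ k) →
                         splitAt m (cast eq (inject≤ x le)) ≡ inj₁ x
  splitAt-cast-inject≤ {m} {n} eq x le = trans (cong (splitAt m) cast≡↑ˡ) (Fin.splitAt-↑ˡ m x n)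
    where
      cast≡↑ˡ : cast eq (inject≤ x le) ≡ x ↑ˡ n
      cast≡↑ˡ =
        Fin.toℕ-injective (trans (Fin.toℕ-cast eq _) (trans (Fin.toℕ-inject≤ x le) (sym (Fin.toℕ-↑ˡ x n))))

  record NestedEnumeration (A : ℕ → Set) (ι : ∀ i → A i → A (suc i)) (size : ℕ → ℕ) : Set where
    field
      size-mono : ∀ i → size i ≤ size (suc i)
      enum : ∀ i → Fin (size i) ↔ A i
      enum-inject≤ : ∀ i x → to (enum (suc i)) (inject≤ x (size-mono i)) ≡ ι i (to (enum i) x)

    prefix⇔image : ∀ i y → (toℕ y < size i) ⇔ (∃ λ a → to (enum (suc i)) y ≡ ι i a)
    prefix⇔image i y = mk⇔ prefix⇒image image⇒prefix
      where
        prefix⇒image : toℕ y < size i → ∃ λ a → to (enum (suc i)) y ≡ ι i a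
        prefix⇒image y<size = to (enum i) x , trans (cong (to (enum (suc i))) y≡x) (enum-inject≤ i x)
          where
            x : Fin (size i)
            x = fromℕ< y<size
            y≡x : y ≡ inject≤ x (size-mono i)
            y≡x = Fin.toℕ-injective (sym (trans (Fin.toℕ-inject≤ x _) (Fin.toℕ-fromℕ< y<size)))
        image⇒prefix : (∃ λ a → to (enum (suc i)) y ≡ ι i a) → toℕ y < size i
        image⇒prefix (a , y↦ιa) =
          subst (_< size i) (trans (sym (Fin.toℕ-inject≤ x _)) (cong toℕ x≡y)) (Fin.toℕ<n x)
          where
            x : Fin (size i)
            x = from (enum i) a
            x≡y : inject≤ x (size-mono i) ≡ y
            x≡y = Injection.injective (↔⇒↣ (enum (suc i)))
                    (trans (enum-inject≤ i x) (trans (cong (ι i) (strictlyInverseˡ (enum i) a)) (sym y↦ιa)))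

    complement : ∀ i → (A i ⊎ Fin (size (suc i) ∸ size i)) ↔ A (suc i)
    complement i =
      ↔-trans (⊎-cong (↔-sym (enum i)) ↔-refl)
        (↔-trans (↔-sym Fin.+↔⊎) (↔-trans (cast↔ (ℕ.m+[n∸m]≡n (size-mono i))) (enum (suc i))))

    complement-inj₁ : ∀ i a → to (complement i) (inj₁ a) ≡ ι i a
    complement-inj₁ i a = begin
      to (enum (suc i)) (cast eq (from (enum i) a ↑ˡ _))
        ≡⟨ cong (to (enum (suc i))) (cast-↑ˡ eq _ (size-mono i)) ⟩
      to (enum (suc i)) (inject≤ (from (enum i) a) (size-mono i))
        ≡⟨ enum-inject≤ i _ ⟩
      ι i (to (enum i) (from (enum i) a))
        ≡⟨ cong (ι i) (strictlyInverseˡ (enum i) a) ⟩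
      ι i a
        ∎
      where
        open ≡-Reasoning
        eq : size i + (size (suc i) ∸ size i) ≡ size (suc i)
        eq = ℕ.m+[n∸m]≡n (size-mono i)

  open NestedEnumeration

  module _ {A : ℕ → Set} {ι : ∀ i → A i → A (suc i)} {size c : ℕ → ℕ}
           (size-suc : ∀ i → size i + c i ≡ size (suc i)) (enum₀ : Fin (size 0) ↔ A 0)
           (grow : ∀ i → (A i ⊎ Fin (c i)) ↔ A (suc i))
           (grow-inj₁ : ∀ i a → to (grow i) (inj₁ a) ≡ ι i a) where

    fromComplementsEnum : ∀ i → Fin (size i) ↔ A i
    fromComplementsEnum zero = enum₀
    fromComplementsEnum (suc i) =
      ↔-trans (cast↔ (sym (size-suc i)))
        (↔-trans Fin.+↔⊎ (↔-trans (⊎-cong (fromComplementsEnum i) ↔-refl) (grow i)))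

    fromComplements : NestedEnumeration A ι size
    fromComplements = record
      { size-mono = size-mono′
      ; enum = fromComplementsEnum
      ; enum-inject≤ = λ i x → trans
          (cong (λ z → to (grow i) (Sum.map₁ (to (fromComplementsEnum i)) z))
                (splitAt-cast-inject≤ (sym (size-suc i)) x (size-mono′ i)))
          (grow-inj₁ i (to (fromComplementsEnum i) x))
      }
      where
        size-mono′ : ∀ i → size i ≤ size (suc i)
        size-mono′ i = subst (size i ≤_) (size-suc i) (ℕ.m≤m+n (size i) (c i))

  module _ {A : ℕ → Set} {ι : ∀ i → A i → A (suc i)} {size : ℕ → ℕ} (E : NestedEnumeration A ι size) where

    reindex : ∀ {size′} → (∀ i → size′ i ≡ size i) → NestedEnumeration A ι size′
    reindex {size′} size′≡size = record
      { size-mono = size-mono′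
      ; enum = λ i → ↔-trans (cast↔ (size′≡size i)) (enum E i)
      ; enum-inject≤ = λ i x → trans (cong (to (enum E (suc i))) (cast-inject≤ i x)) (enum-inject≤ E i _)
      }
      where
        size-mono′ : ∀ i → size′ i ≤ size′ (suc i)
        size-mono′ i = subst₂ _≤_ (sym (size′≡size i)) (sym (size′≡size (suc i))) (size-mono E i)
        cast-inject≤ : ∀ i x → cast (size′≡size (suc i)) (inject≤ x (size-mono′ i)) ≡
                                inject≤ (cast (size′≡size i) x) (size-mono E i)
        cast-inject≤ i x = Fin.toℕ-injective (begin
          toℕ (cast _ (inject≤ x _))  ≡⟨ Fin.toℕ-cast _ _ ⟩
          toℕ (inject≤ x _)           ≡⟨ Fin.toℕ-inject≤ x _ ⟩
          toℕ x                       ≡⟨ Fin.toℕ-cast _ x ⟨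
          toℕ (cast _ x)              ≡⟨ Fin.toℕ-inject≤ _ _ ⟨
          toℕ (inject≤ (cast _ x) _)  ∎)
          where open ≡-Reasoning

    transport : ∀ {A′ : ℕ → Set} {ι′ : ∀ i → A′ i → A′ (suc i)} (e : ∀ i → A i ↔ A′ i) →
                (∀ i a → to (e (suc i)) (ι i a) ≡ ι′ i (to (e i) a)) → NestedEnumeration A′ ι′ size
    transport e e-ι = record
      { size-mono = size-mono E
      ; enum = λ i → ↔-trans (enum E i) (e i)
      ; enum-inject≤ = λ i x → trans (cong (to (e (suc i))) (enum-inject≤ E i x)) (e-ι i _)
      }

  finEnumeration : ∀ (m : ℕ → ℕ) (m-mono : ∀ i → m i ≤ m (suc i)) →
                   NestedEnumeration (λ i → Fin (m i)) (λ i x → inject≤ x (m-mono i)) m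
  finEnumeration m m-mono = record { size-mono = m-mono ; enum = λ _ → ↔-refl ; enum-inject≤ = λ _ _ → refl }

  module _ {A B : ℕ → Set} {ι : ∀ i → A i → A (suc i)} {κ : ∀ i → B i → B (suc i)} {a b : ℕ → ℕ}
           (EA : NestedEnumeration A ι a) (EB : NestedEnumeration B κ b) where

    private
      Δa Δb Δab : ℕ → ℕ
      Δa i = a (suc i) ∸ a i
      Δb i = b (suc i) ∸ b i
      Δab i = a i * Δb i + Δa i * b (suc i)

      size-suc : ∀ i → a i * b i + Δab i ≡ a (suc i) * b (suc i)
      size-suc i = begin
        a i * b i + (a i * Δb i + Δa i * b′)  ≡⟨ ℕ.+-assoc (a i * b i) _ _ ⟨
        a i * b i + a i * Δb i + Δa i * b′    ≡⟨ cong (_+ Δa i * b′) (ℕ.*-distribˡ-+ (a i) (b i) (Δb i)) ⟨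
        a i * (b i + Δb i) + Δa i * b′        ≡⟨ cong (λ v → a i * v + Δa i * b′) (ℕ.m+[n∸m]≡n (size-mono EB i)) ⟩
        a i * b′ + Δa i * b′                  ≡⟨ ℕ.*-distribʳ-+ b′ (a i) (Δa i) ⟨
        (a i + Δa i) * b′                     ≡⟨ cong (_* b′) (ℕ.m+[n∸m]≡n (size-mono EA i)) ⟩
        a (suc i) * b′                        ∎
        where
          open ≡-Reasoning
          b′ : ℕ
          b′ = b (suc i)

      new : ∀ i → Fin (Δab i) ↔ ((A i × Fin (Δb i)) ⊎ (Fin (Δa i) × B (suc i)))
      new i = ↔-trans Fin.+↔⊎ (⊎-cong (↔-trans Fin.*↔× (×-cong (enum EA i) ↔-refl))
                                       (↔-trans Fin.*↔× (×-cong ↔-refl (enum EB (suc i)))))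

      grow : ∀ i → ((A i × B i) ⊎ Fin (Δab i)) ↔ (A (suc i) × B (suc i))
      grow i = ↔-trans (⊎-cong ↔-refl (new i))
               (↔-trans (↔-sym (⊎-assoc _ _ _ _))
               (↔-trans (⊎-cong (↔-sym (×-distribˡ-⊎ _ _ _ _)) ↔-refl)
               (↔-trans (⊎-cong (×-cong ↔-refl (complement EB i)) ↔-refl)
               (↔-trans (↔-sym (×-distribʳ-⊎ _ _ _ _))
                        (×-cong (complement EA i) ↔-refl)))))

    ×-enumeration : NestedEnumeration (λ i → A i × B i) (λ i → Product.map (ι i) (κ i)) (λ i → a i * b i)
    ×-enumeration = fromComplements size-suc (↔-trans Fin.*↔× (×-cong (enum EA 0) (enum EB 0))) grow
      (λ i (x , y) → cong₂ _,_ (complement-inj₁ EA i x) (complement-inj₁ EB i y))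

  ×↔Vec-suc : ∀ {X : Set} {K} → (X × Vec X K) ↔ Vec X (suc K)
  ×↔Vec-suc = mk↔ₛ′ (uncurry _∷_) uncons (λ { (_ ∷ _) → refl }) (λ _ → refl)

  1↔Vec-zero : ∀ {X : Set} → Fin 1 ↔ Vec X 0
  1↔Vec-zero = mk↔ₛ′ (λ _ → []) (λ _ → Data.Fin.zero)
                     (λ { [] → refl }) (λ { Data.Fin.zero → refl ; (Data.Fin.suc ()) })

  vecEnumeration : ∀ {A ι a} → NestedEnumeration A ι a → ∀ K →
                   NestedEnumeration (λ i → Vec (A i) K) (λ i → Vec.map (ι i)) (λ i → a i ^ K)
  vecEnumeration E zero =
    record { size-mono = λ _ → ℕ.≤-refl ; enum = λ _ → 1↔Vec-zero ; enum-inject≤ = λ _ _ → refl }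
  vecEnumeration E (suc K) = transport (×-enumeration E (vecEnumeration E K)) (λ _ → ×↔Vec-suc) (λ _ _ → refl)

  inject≤-image⇔ : ∀ {m n} (le : m ≤ n) (y : Fin n) → (∃ λ x → y ≡ inject≤ x le) ⇔ (toℕ y < m)
  inject≤-image⇔ le y = mk⇔
    (λ { (x , refl) → subst (_< _) (sym (Fin.toℕ-inject≤ x le)) (Fin.toℕ<n x) })
    (λ y<m → fromℕ< y<m , Fin.toℕ-injective (sym (trans (Fin.toℕ-inject≤ _ le) (Fin.toℕ-fromℕ< y<m))))

  ×-image⇔ : ∀ {X X′ Y Y′ : Set} (f : X → X′) (g : Y → Y′) (z : X′ × Y′) →
             (∃ λ p → z ≡ Product.map f g p) ⇔ ((∃ λ x → proj₁ z ≡ f x) × (∃ λ y → proj₂ z ≡ g y))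
  ×-image⇔ f g z = mk⇔ (λ { ((x , y) , refl) → (x , refl) , (y , refl) })
                       (λ { ((x , refl) , (y , refl)) → (x , y) , refl })

  Vec-image⇔ : ∀ {X X′ : Set} {K} (f : X → X′) (w : Vec X′ K) →
               (∃ λ v → w ≡ Vec.map f v) ⇔ All (λ y → ∃ λ x → y ≡ f x) w
  Vec-image⇔ f w = mk⇔ image⇒All All⇒image
    where
      image⇒All : ∀ {K} {w : Vec _ K} → (∃ λ v → w ≡ Vec.map f v) → All (λ y → ∃ λ x → y ≡ f x) w
      image⇒All ([] , refl) = []
      image⇒All (x ∷ v , refl) = (x , refl) ∷ image⇒All (v , refl)
      All⇒image : ∀ {K} {w : Vec _ K} → All (λ y → ∃ λ x → y ≡ f x) w → ∃ λ v → w ≡ Vec.map f v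
      All⇒image [] = [] , refl
      All⇒image ((x , refl) ∷ ps) with All⇒image ps
      ... | v , refl = x ∷ v , refl
module CeilingDivision (k′ : ℕ) where
  open import Data.Nat.Properties
  open import Data.Nat.DivMod using (_/_; _%_; m/n*n≤m; m≡m%n+[m/n]*n; m%n<n; /-monoˡ-≤; m*n/n≡m)
  open import Relation.Binary.PropositionalEquality

  private
    k : ℕ
    k = suc k′

  ceilDiv*k≤ : ∀ a → ceilDiv a k * k ≤ a + k′
  ceilDiv*k≤ a = m/n*n≤m (a + k′) k

  ≤ceilDiv*k : ∀ a → a ≤ ceilDiv a k * k
  ≤ceilDiv*k a = +-cancelʳ-≤ k′ a _ (≤-pred (begin
    suc (a + k′)                  ≡⟨ cong suc (m≡m%n+[m/n]*n (a + k′) k) ⟩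
    suc ((a + k′) % k + c * k)    ≤⟨ +-monoˡ-≤ (c * k) (m%n<n (a + k′) k) ⟩
    k + c * k                     ≡⟨ +-comm k (c * k) ⟩
    c * k + k                     ≡⟨ +-suc (c * k) k′ ⟩
    suc (c * k + k′)              ∎))
    where
      open ≤-Reasoning
      c : ℕ
      c = ceilDiv a k

  [ceilDiv∸1]*k+1≤ : ∀ a → 1 ≤ a → (ceilDiv a k ∸ 1) * k + 1 ≤ a
  [ceilDiv∸1]*k+1≤ a 1≤a with ceilDiv a k | ceilDiv*k≤ a
  ... | zero | _ = 1≤a
  ... | suc c | ck≤a+k′ = +-cancelʳ-≤ k′ _ a (begin
    c * k + 1 + k′   ≡⟨ +-assoc (c * k) 1 k′ ⟩
    c * k + k        ≡⟨ +-comm (c * k) k ⟩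
    suc c * k        ≤⟨ ck≤a+k′ ⟩
    a + k′           ∎)
    where open ≤-Reasoning

  ≤[ceilDiv∸1]*k+k : ∀ a → a ≤ (ceilDiv a k ∸ 1) * k + k
  ≤[ceilDiv∸1]*k+k a with ceilDiv a k | ≤ceilDiv*k a
  ... | zero | a≤0 = ≤-trans a≤0 z≤n
  ... | suc c | a≤ck = ≤-trans a≤ck (≤-reflexive (+-comm k (c * k)))

  ceilDiv∸1-mono-≤ : ∀ {a b} → a ≤ b → ceilDiv a k ∸ 1 ≤ ceilDiv b k ∸ 1
  ceilDiv∸1-mono-≤ a≤b = ∸-monoˡ-≤ 1 (/-monoˡ-≤ k (+-monoˡ-≤ k′ a≤b))

  *k<⇒≤ceilDiv∸1 : ∀ x a → x * k < a → x ≤ ceilDiv a k ∸ 1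
  *k<⇒≤ceilDiv∸1 x a xk<a = ∸-monoˡ-≤ 1 (begin
    suc x                ≡⟨ m*n/n≡m (suc x) k ⟨
    suc x * k / k        ≤⟨ /-monoˡ-≤ k (begin
      suc x * k          ≡⟨ +-comm k (x * k) ⟩
      x * k + k          ≡⟨ +-suc (x * k) k′ ⟩
      suc (x * k + k′)   ≤⟨ +-monoˡ-≤ k′ xk<a ⟩
      a + k′             ∎) ⟩
    ceilDiv a k          ∎)
    where open ≤-Reasoning

module Sequence (d₀ k′ q : ℕ) (1≤d₀ : 1 ≤ d₀) (d₀k<q : d₀ * suc k′ < q) where
  open import Data.Nat using (NonZero; >-nonZero)
  open import Data.Nat.Properties
  open import Relation.Binary.PropositionalEquality
  open CeilingDivision k′

  k : ℕ
  k = suc k′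

  m : ℕ → ℕ
  m i = q ^ (2 ^ i)

  d : ℕ → ℕ
  d = dSeq d₀ k q

  D : ℕ → ℕ
  D i = d i * k + 1

  m-zero : m 0 ≡ q
  m-zero = *-identityʳ q

  m-suc : ∀ i → m (suc i) ≡ m i * m i
  m-suc i = trans (cong (λ e → q ^ (2 ^ i + e)) (+-identityʳ (2 ^ i))) (^-distribˡ-+-* q (2 ^ i) (2 ^ i))

  2≤q : 2 ≤ q
  2≤q = ≤-trans (s≤s (≤-trans (s≤s z≤n) (m≤n*m k d₀ ⦃ >-nonZero 1≤d₀ ⦄))) d₀k<q

  2≤m : ∀ i → 2 ≤ m i
  2≤m zero = subst (2 ≤_) (sym m-zero) 2≤q
  2≤m (suc i) = subst (2 ≤_) (sym (m-suc i)) (*-mono-≤ (2≤m i) (≤-trans (s≤s z≤n) (2≤m i)))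

  m-mono : ∀ i → m i ≤ m (suc i)
  m-mono i = subst (m i ≤_) (sym (m-suc i)) (m≤m*n (m i) (m i) ⦃ nonZero ⦄)
    where
      nonZero : NonZero (m i)
      nonZero = >-nonZero (≤-trans (s≤s z≤n) (2≤m i))

  i<m : ∀ i → i < m i
  i<m zero = ≤-trans (s≤s z≤n) (2≤m 0)
  i<m (suc i) = subst (suc i <_) (sym (m-suc i)) (begin-strict
    suc i       ≤⟨ i<m i ⟩
    m i         <⟨ m<m+n (m i) (≤-trans (s≤s z≤n) (2≤m i)) ⟩
    m i + m i   ≡⟨ cong (m i +_) (+-identityʳ (m i)) ⟨
    2 * m i     ≤⟨ *-monoˡ-≤ (m i) (2≤m i) ⟩
    m i * m i   ∎)
    where open ≤-Reasoning

  D≤m : ∀ i → D i ≤ m i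
  D≤m zero = subst (d₀ * k + 1 ≤_) (sym m-zero) (subst (_≤ q) (+-comm 1 (d₀ * k)) d₀k<q)
  D≤m (suc i) = [ceilDiv∸1]*k+1≤ (m (suc i)) (≤-trans (s≤s z≤n) (2≤m (suc i)))

  d-mono : ∀ i → d i ≤ d (suc i)
  d-mono zero = *k<⇒≤ceilDiv∸1 d₀ (m 1) (≤-trans d₀k<q (subst (_≤ m 1) m-zero (m-mono 0)))
  d-mono (suc i) = ceilDiv∸1-mono-≤ (m-mono (suc i))

  D-mono : ∀ i → D i ≤ D (suc i)
  D-mono i = +-monoˡ-≤ 1 (*-monoˡ-≤ k (d-mono i))

  m≤qk*D : ∀ i → m i ≤ q * k * D i
  m≤qk*D zero = subst (_≤ q * k * D 0) (sym m-zero)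
    (≤-trans (m≤m*n q k) (m≤m*n (q * k) (D 0) ⦃ >-nonZero (m≤n+m 1 (d₀ * k)) ⦄))
  m≤qk*D (suc i) = begin
    m (suc i)                    ≤⟨ ≤[ceilDiv∸1]*k+k (m (suc i)) ⟩
    d (suc i) * k + k            ≡⟨ cong (d (suc i) * k +_) (*-identityʳ k) ⟨
    d (suc i) * k + k * 1        ≤⟨ +-monoˡ-≤ (k * 1) (m≤n*m (d (suc i) * k) k) ⟩
    k * (d (suc i) * k) + k * 1  ≡⟨ *-distribˡ-+ k (d (suc i) * k) 1 ⟨
    k * D (suc i)                ≤⟨ *-monoˡ-≤ (D (suc i)) (m≤n*m k q ⦃ >-nonZero (≤-trans (s≤s z≤n) 2≤q) ⦄) ⟩
    q * k * D (suc i)            ∎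
    where open ≤-Reasoning

  absDiff-dk-m≤k : ∀ i → absDiff (d (suc i) * k) (m (suc i)) ≤ k
  absDiff-dk-m≤k i = begin
    (d (suc i) * k ∸ m (suc i)) + (m (suc i) ∸ d (suc i) * k)
        ≡⟨ cong (_+ (m (suc i) ∸ d (suc i) * k)) (m≤n⇒m∸n≡0 (≤-trans (m≤m+n _ 1) (D≤m (suc i)))) ⟩
    m (suc i) ∸ d (suc i) * k
        ≤⟨ m≤n+o⇒m∸n≤o (m (suc i)) (d (suc i) * k) (≤[ceilDiv∸1]*k+k (m (suc i))) ⟩
    k   ∎
    where open ≤-Reasoning

  d*k-close-to-m : ∀ e i → suc (suc e * k) ≤ i → suc e * absDiff (d i * k) (m i) ≤ m i
  d*k-close-to-m e (suc i) (s≤s ek<i) = begin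
    suc e * absDiff (d (suc i) * k) (m (suc i))  ≤⟨ *-monoʳ-≤ (suc e) (absDiff-dk-m≤k i) ⟩
    suc e * k                                    ≤⟨ ≤-trans ek<i (n≤1+n i) ⟩
    suc i                                        ≤⟨ <⇒≤ (i<m (suc i)) ⟩
    m (suc i)                                    ∎
    where open ≤-Reasoning

module Powers where
  open import Data.Nat.Properties
  open import Relation.Binary.PropositionalEquality
  open import Relation.Binary.Definitions using (tri<; tri≈; tri>)
  open import Relation.Nullary using (contradiction)
  open import Data.Nat.Solver using (module +-*-Solver)
  open +-*-Solver

  ^-distribʳ-* : ∀ a b n → (a * b) ^ n ≡ a ^ n * b ^ n
  ^-distribʳ-* a b zero = refl
  ^-distribʳ-* a b (suc n) = begin
    a * b * (a * b) ^ n        ≡⟨ cong (a * b *_) (^-distribʳ-* a b n) ⟩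
    a * b * (a ^ n * b ^ n)    ≡⟨ solve 4 (λ a b x y → a :* b :* (x :* y) := a :* x :* (b :* y))
                                        refl a b (a ^ n) (b ^ n) ⟩
    a * a ^ n * (b * b ^ n)    ∎
    where open ≡-Reasoning

  ^-injectiveˡ : ∀ p {r s} → r ^ suc p ≡ s ^ suc p → r ≡ s
  ^-injectiveˡ p {r} {s} r^P≡s^P with <-cmp r s
  ... | tri< r<s _ _ = contradiction r^P≡s^P (<⇒≢ (^-monoˡ-< (suc p) r<s))
  ... | tri≈ _ r≡s _ = r≡s
  ... | tri> _ _ r>s = contradiction (sym r^P≡s^P) (<⇒≢ (^-monoˡ-< (suc p) r>s))

  n^P≤c^P*[D*m]^P*n^p : ∀ c D m p {n} → m ≤ c * D → n ≡ m ^ suc (suc p) →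
            n ^ suc (suc p) ≤ c ^ suc (suc p) * (D * m) ^ suc (suc p) * n ^ p
  n^P≤c^P*[D*m]^P*n^p c D m p {n} m≤cD refl = begin
    n * (n * n ^ p)              ≡⟨ solve 2 (λ x y → x :* (x :* y) := x :* x :* y) refl n (n ^ p) ⟩
    n * n * n ^ p                ≤⟨ *-monoˡ-≤ (n ^ p) (*-monoˡ-≤ n (^-monoˡ-≤ P m≤cD)) ⟩
    (c * D) ^ P * n * n ^ p      ≡⟨ cong (λ v → v * n * n ^ p) (^-distribʳ-* c D P) ⟩
    c ^ P * D ^ P * n * n ^ p    ≡⟨ cong (_* n ^ p) (*-assoc (c ^ P) (D ^ P) n) ⟩
    c ^ P * (D ^ P * n) * n ^ p  ≡⟨ cong (λ v → c ^ P * v * n ^ p) (^-distribʳ-* D m P) ⟨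
    c ^ P * (D * m) ^ P * n ^ p  ∎
    where
      open ≤-Reasoning
      P : ℕ
      P = suc (suc p)


module Construction (d₀ k′ q : ℕ) (1≤d₀ : 1 ≤ d₀) (d₀k<q : d₀ * suc k′ < q)
                    (F : (i : ℕ) → FinField (q ^ (2 ^ i)))
                    (h : (i : ℕ) → Fin (q ^ (2 ^ i)) → Fin (q ^ (2 ^ suc i)))
                    (h-toℕ : ∀ i x → toℕ (h i x) ≡ toℕ x)
                    (h-hom : ∀ i → IsFieldHom (F i) (F (suc i)) (h i)) where
  import Data.Nat.Properties as ℕ
  open import Data.Fin using (inject≤)
  import Data.Vec as Vec
  import Data.Vec.Relation.Unary.All as All
  import Data.Product as Product
  open import Data.Product.Function.NonDependent.Propositional using (_×-⇔_)
  open import Function.Bundles using (Inverse; Equivalence; mk⇔)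
  open import Function.Properties.Inverse using (↔⇒⤖)
  open import Function.Properties.Equivalence using () renaming (trans to ⇔-trans)
  open import Relation.Binary.PropositionalEquality using (sym; trans; cong; cong₂; subst)
  open Sequence d₀ k′ q 1≤d₀ d₀k<q
  open Enumeration
  open NestedEnumeration
  open Inverse using (to)
  open CoverFree using (IsCoverFree⇒IsCFF; CMat-isCoverFree)
  open Powers using (n^P≤c^P*[D*m]^P*n^p; ^-injectiveˡ)

  n : ℕ → ℕ
  n i = q ^ (2 ^ i * (k + 1))

  n≡m^[1+k] : ∀ i → n i ≡ m i ^ suc k
  n≡m^[1+k] i = trans (cong (λ e → q ^ (2 ^ i * e)) (ℕ.+-comm k 1)) (sym (ℕ.^-*-assoc q (2 ^ i) (suc k)))

  rowEnum : NestedEnumeration (λ i → Fin (D i) × Fin (m i))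
              (λ i → Product.map (λ j → inject≤ j (D-mono i)) (λ y → inject≤ y (m-mono i))) (λ i → D i * m i)
  rowEnum = ×-enumeration (finEnumeration D D-mono) (finEnumeration m m-mono)

  columnEnum : NestedEnumeration (λ i → Vec (Fin (m i)) (suc k)) (λ i → Vec.map (λ y → inject≤ y (m-mono i))) n
  columnEnum = reindex (vecEnumeration (finEnumeration m m-mono) (suc k)) n≡m^[1+k]

  σ : (i : ℕ) → Fin (D i * m i) ⤖ (Fin (D i) × Fin (m i))
  σ i = ↔⇒⤖ (enum rowEnum i)

  τ : (i : ℕ) → Fin (n i) ⤖ Vec (Fin (m i)) (suc k)
  τ i = ↔⇒⤖ (enum columnEnum i)

  upper-left : ∀ i x c →
               CMat (F i) k (d i) (to (enum rowEnum i) x) (to (enum columnEnum i) c) ≡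
               CMat (F (suc i)) k (d (suc i)) (to (enum rowEnum (suc i)) (inject≤ x (size-mono rowEnum i)))
                                              (to (enum columnEnum (suc i)) (inject≤ c (size-mono columnEnum i)))
  upper-left i x c = trans
    (Embedding.CMat-embedding (F i) (F (suc i)) (h i) (h-toℕ i) (h-hom i) k {d i} {d (suc i)}
                              (m-mono i) (D≤m i) (D-mono i) (D≤m (suc i)) _ _ _)
    (sym (cong₂ (CMat (F (suc i)) k (d (suc i))) (enum-inject≤ rowEnum i x) (enum-inject≤ columnEnum i c)))

  isEmbeddingFamily : IsEmbeddingFamily (λ i → D i * m i) n d
                        (λ i x c → CMat (F i) k (d i) (Bijection.to (σ i) x) (Bijection.to (τ i) c))
  isEmbeddingFamily = record
    { t-mono = size-mono rowEnum
    ; n-mono = size-mono columnEnum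
    ; d-mono = d-mono
    ; cff = λ i → IsCoverFree⇒IsCFF (CMat-isCoverFree (F i) k (d i) (D≤m i)) (σ i) (τ i)
    ; upper-left = upper-left
    }

  rows-prefix : ∀ i (x : Fin (D (suc i) * m (suc i))) →
                (toℕ x < D i * m i) ⇔
                (toℕ (proj₁ (to (enum rowEnum (suc i)) x)) < D i × toℕ (proj₂ (to (enum rowEnum (suc i)) x)) < m i)
  rows-prefix i x = ⇔-trans (prefix⇔image rowEnum i x)
    (⇔-trans (×-image⇔ _ _ _) (inject≤-image⇔ (D-mono i) _ ×-⇔ inject≤-image⇔ (m-mono i) _))

  columns-prefix : ∀ i (c : Fin (n (suc i))) →
                   (toℕ c < n i) ⇔ All (λ a → toℕ a < m i) (to (enum columnEnum (suc i)) c)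
  columns-prefix i c = ⇔-trans (prefix⇔image columnEnum i c)
    (⇔-trans (Vec-image⇔ _ _) (mk⇔ (All.map (Equivalence.to (inject≤-image⇔ (m-mono i) _)))
                                   (All.map (Equivalence.from (inject≤-image⇔ (m-mono i) _)))))

  compression : ∀ i → n i ^ (k + 1) ≤ (q * k) ^ (k + 1) * (D i * m i) ^ (k + 1) * n i ^ (k ∸ 1)
  compression i = subst (λ P → n i ^ P ≤ (q * k) ^ P * (D i * m i) ^ P * n i ^ k′) (ℕ.+-comm 1 k)
                    (n^P≤c^P*[D*m]^P*n^p (q * k) (D i) (m i) k′ (m≤qk*D i) (n≡m^[1+k] i))

  d*k-close-to-root : ∀ e i → suc (suc e * k) ≤ i → ∀ r → r ^ (k + 1) ≡ n i →
                      suc e * absDiff (d i * k) r ≤ r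
  d*k-close-to-root e i N≤i r r^[k+1]≡n =
    subst (λ x → suc e * absDiff (d i * k) x ≤ x) (sym r≡m) (d*k-close-to-m e i N≤i)
    where
      r≡m : r ≡ m i
      r≡m = ^-injectiveˡ k (trans (cong (r ^_) (ℕ.+-comm 1 k)) (trans r^[k+1]≡n (n≡m^[1+k] i)))

corollary1 : (d₀ k q : ℕ) → 1 ≤ d₀ → 1 ≤ k → IsPrimePower q → d₀ * k < q →
  (F : (i : ℕ) → FinField (q ^ (2 ^ i))) →
  (h : (i : ℕ) → Fin (q ^ (2 ^ i)) → Fin (q ^ (2 ^ suc i))) →
  (∀ i x → toℕ (h i x) ≡ toℕ x) →
  (∀ i → IsFieldHom (F i) (F (suc i)) (h i)) →
  let d = dSeq d₀ k q
      m = λ (i : ℕ) → q ^ (2 ^ i)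
      t = λ (i : ℕ) → (d i * k + 1) * m i
      n = λ (i : ℕ) → q ^ (2 ^ i * (k + 1))
  in Σ ((i : ℕ) → Fin (t i) ⤖ (Fin (d i * k + 1) × Fin (m i))) λ σ →
     Σ ((i : ℕ) → Fin (n i) ⤖ Vec (Fin (m i)) (suc k)) λ τ →
     IsEmbeddingFamily t n d
       (λ i x c → CMat (F i) k (d i) (Bijection.to (σ i) x) (Bijection.to (τ i) c))
     × (∀ i (x : Fin (t (suc i))) →
          (toℕ x < t i) ⇔
          (toℕ (proj₁ (Bijection.to (σ (suc i)) x)) < d i * k + 1
           × toℕ (proj₂ (Bijection.to (σ (suc i)) x)) < m i))
     × (∀ i (c : Fin (n (suc i))) →
          (toℕ c < n i) ⇔ All (λ a → toℕ a < m i) (Bijection.to (τ (suc i)) c))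
     × (Σ ℕ λ C → ∀ i → n i ^ (k + 1) ≤ C * t i ^ (k + 1) * n i ^ (k ∸ 1))
     × (∀ e → Σ ℕ λ N → ∀ i → N ≤ i → ∀ r → r ^ (k + 1) ≡ n i →
          suc e * absDiff (d i * k) r ≤ r)
corollary1 d₀ k@(suc k′) q 1≤d₀ (s≤s z≤n) _ d₀k<q F h h-toℕ h-hom =
  σ , τ , isEmbeddingFamily , rows-prefix , columns-prefix , ((q * k) ^ (k + 1) , compression) ,
  λ e → _ , d*k-close-to-root e
  where open Construction d₀ k′ q 1≤d₀ d₀k<q F h h-toℕ h-hom
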